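{- The tape machine $\mathcal T_1$ defined below is constant-delay, Hamiltonian and Hamming-1, for word lengths $\ell\ge3$ (i.e., for every $\ell\ge3$ its run on $0^\ell$ halts and produces every word of $\{0,1\}^\ell$ exactly once, consecutive produced words differ in exactly one bit, and there is a constant $B$ independent of $\ell$ bounding the number of steps before the first output, between consecutive outputs and after the last output). $\mathcal T_1$ has states $\{q_{\mathrm i},\uparrow,\downarrow,q_{\mathrm h}\}$, initial state $q_{\mathrm i}$, halting state $q_{\mathrm h}$, and all four states are output states. Index tape cells $0,\dots,\ell+1$ (cell $0$ holds $\triangleright$, cell $\ell+1$ holds $\triangleleft$), let $h$ be the head position, and for a bit $x$ let $\bar x=1-x$. Its (macro-)transitions are: (1) in $q_{\mathrm i}$, if cell $h-1$ is $\triangleright$, cell $h$ is $0$ and cell $h+1$ is $0$: set cell $h+1$ to $1$, move head to $h+1$, go to $\downarrow$; (2) in $\downarrow$, if cell $h-2\in\{0,1,\triangleright\}$, cell $h-1\in\{0,1\}$, cell $h$ is $1$ and cell $h+1$ is $0$: set cell $h+1$ to $1$, move head to $h+1$, stay in $\downarrow$; (3) in $\downarrow$, if cell $h-2\in\{0,1,\triangleright\}$, cell $h-1$ holds a bit $x\in\{0,1\}$, cell $h$ is $1$ and cell $h+1$ is $\triangleleft$: set cell $h-1$ to $\bar x$, head stays, go to $\uparrow$; (4) in $\uparrow$, if cell $h-2$ holds a bit $x\in\{0,1\}$, cell $h-1$ is $0$, cell $h$ is $1$ and cell $h+1\in\{0,\triangleleft\}$: set cell $h-2$ to $\bar x$,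 head stays, go to $\downarrow$; (5) in $\uparrow$, if cell $h-2\in\{0,1\}$, cell $h-1$ is $1$, cell $h$ is $1$ and cell $h+1\in\{0,\triangleleft\}$: set cell $h$ to $0$, move head to $h-1$, stay in $\uparrow$; (6) in $\uparrow$, if cell $h-2$ is $\triangleright$, cell $h-1$ is $1$, cell $h$ is $1$ and cell $h+1$ is $0$: set cell $h$ to $0$, move head to $h-1$, go to $q_{\mathrm h}$. No other transitions are defined (a run reaching an undefined case does not halt).
   Context: Tape machines: a finite set of states with an initial state $q_{\mathrm i}$, halting state $q_{\mathrm h}$ and output states; a single tape $\triangleright w\triangleleft$ with $w\in\{0,1\}^\ell$ and a single head; markers are never overwritten. Transitions here are macro-transitions that read a constant-size window of cells around the head and rewrite them, move the head by at most one cell and change state; each macro-transition counts as one step (it can be simulated by a constant number of ordinary one-cell steps). For length $\ell$ the run starts in state $q_{\mathrm i}$ with tape $\triangleright0^\ell\triangleleft$ and head on cell $1$, and stops on reaching $q_{\mathrm h}$. Whenever the current state is an output state (including at the initial and the halting configuration here), the machine produces in unit time the current word (tape content without markers). -}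

module Defs where

open import Data.Bool using (Bool; true; false; not; if_then_else_; _xor_)
open import Data.Nat using (ℕ; zero; suc; _∸_; _≤_; _+_)
open import Data.List using (List; []; _∷_; _++_; map; filter; length)
open import Data.Maybe using (Maybe; just; nothing)
open import Data.Product using (Σ; _×_; _,_; proj₁; proj₂)
open import Data.List.Relation.Unary.Linked using (Linked)
open import Relation.Nullary.Decidable using (Dec; yes; no)
open import Relation.Binary.PropositionalEquality using (_≡_; refl)

-- Tape symbols; `none` is returned when reading outside cells 0..ℓ+1.
data Sym : Set where
  ▷ ◁ none : Sym
  bit : Bool → Sym

data State : Set where
  qi up down qh : State

isOutput : State → Bool
isOutput _ = true

-- Configuration: state, word w ∈ {0,1}^ℓ (tape without markers), head position h
record Config : Set where
  constructor ⟨_,_,_⟩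
  field
    state : State
    word  : List Bool
    head  : ℕ
open Config public

-- Reading cells 1..ℓ+1 : cellR w i = content of cell i+1
cellR : List Bool → ℕ → Sym
cellR []      zero    = ◁
cellR []      (suc _) = none
cellR (b ∷ w) zero    = bit b
cellR (b ∷ w) (suc i) = cellR w i

-- cell w i = content of cell i of the tape ▷ w ◁ (cell 0 is ▷, cell ℓ+1 is ◁)
cell : List Bool → ℕ → Sym
cell w zero    = ▷
cell w (suc i) = cellR w i

-- cells h-2, h-1, h, h+1 (negative positions read as `none`)
cm2 : List Bool → ℕ → Sym
cm2 w (suc (suc h)) = cell w h
cm2 w _             = none

cm1 : List Bool → ℕ → Sym
cm1 w (suc h) = cell w h
cm1 w zero    = none

c0 : List Bool → ℕ → Sym
c0 w h = cell w h

cp1 : List Bool → ℕ → Sym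
cp1 w h = cell w (suc h)

-- writing bit b into cell i (1 ≤ i ≤ ℓ); markers are never overwritten
setR : List Bool → ℕ → Bool → List Bool
setR []      _       b = []
setR (x ∷ w) zero    b = b ∷ w
setR (x ∷ w) (suc i) b = x ∷ setR w i b

set : List Bool → ℕ → Bool → List Bool
set w zero    b = w
set w (suc i) b = setR w i b

stepQi : List Bool → ℕ → Maybe Config
stepQi w h with cm1 w h | c0 w h | cp1 w h
... | ▷ | bit false | bit false = just ⟨ down , set w (suc h) true , suc h ⟩
... | _ | _ | _ = nothing

leftOK : Sym → Bool
leftOK ▷       = true
leftOK (bit _) = true
leftOK _       = false

stepDown : List Bool → ℕ → Maybe Config
stepDown w h with leftOK (cm2 w h) | cm1 w h | c0 w h | cp1 w h
... | true | bit x | bit true | bit false = just ⟨ down , set w (suc h) true , suc h ⟩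
... | true | bit x | bit true | ◁         = just ⟨ up , set w (h ∸ 1) (not x) , h ⟩
... | _ | _ | _ | _ = nothing

rightOK : Sym → Bool
rightOK (bit false) = true
rightOK ◁           = true
rightOK _           = false

stepUp : List Bool → ℕ → Maybe Config
stepUp w h with cm2 w h | cm1 w h | c0 w h | cp1 w h | rightOK (cp1 w h)
... | bit x | bit false | bit true | _         | true = just ⟨ down , set w (h ∸ 2) (not x) , h ⟩
... | bit _ | bit true  | bit true | _         | true = just ⟨ up , set w h false , h ∸ 1 ⟩
... | ▷     | bit true  | bit true | bit false | _    = just ⟨ qh , set w h false , h ∸ 1 ⟩
... | _ | _ | _ | _ | _ = nothing

step : Config → Maybe Config
step ⟨ qi   , w , h ⟩ = stepQi w h
step ⟨ down , w , h ⟩ = stepDown w h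
step ⟨ up   , w , h ⟩ = stepUp w h
step ⟨ qh   , w , h ⟩ = nothing

zeros : ℕ → List Bool
zeros zero    = []
zeros (suc n) = false ∷ zeros n

init : ℕ → Config
init ℓ = ⟨ qi , zeros ℓ , 1 ⟩

iter : ℕ → Config → Maybe Config
iter zero    c = just c
iter (suc n) c with step c
... | just c' = iter n c'
... | nothing = nothing

-- The run from c reaches the halting state after exactly N steps
-- (qh has no transitions, so N is the first time qh is reached)
HaltsAt : Config → ℕ → Set
HaltsAt c N = Σ Config λ c' → iter N c ≡ just c' × state c' ≡ qh

trace : ℕ → ℕ → Config → List (ℕ × Config)
trace t zero    c = (t , c) ∷ []
trace t (suc n) c with step c
... | just c' = (t , c) ∷ trace (suc t) n c'
... | nothing = (t , c) ∷ []

outs : List (ℕ × Config) → List (ℕ × List Bool)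
outs []             = []
outs ((t , c) ∷ r) = if isOutput (state c) then (t , word c) ∷ outs r else outs r

outputs : ℕ → ℕ → List (ℕ × List Bool)
outputs ℓ N = outs (trace 0 N (init ℓ))

ham : List Bool → List Bool → ℕ
ham (a ∷ u) (b ∷ v) = (if a xor b then 1 else 0) + ham u v
ham _       _       = 0

-- delay bound B: steps before the first output, between consecutive outputs,
-- and after the last output (until halting at time N) are all ≤ B
DelayBounded : ℕ → ℕ → List ℕ → Set
DelayBounded B N ts = Linked (λ s t → t ∸ s ≤ B) (0 ∷ ts ++ N ∷ [])

{-# OPTIONS --safe #-}
module Submission where

-- Write pivot n = 1 0ⁿ. Started in state ↓ on a tape p x (pivot k) with the head on the
-- 1 of the pivot, T₁ visits exactly the words p w, w in sweep x (k + 1), and ends in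
-- state ↑ on p x̄ (pivot k): for k > 0, transition (2) extends the pivot to give
-- (p x) 1 (pivot (k - 1)), which is swept recursively, (4) complements x, the tape
-- (p x̄) 0 (pivot (k - 1)) is swept, and (5) retracts the pivot; for k = 0 the sweep is
-- transition (3) alone. The list sweep x n consists of the words a t with t a nonzero
-- word of length n, each once. Hence the run on 0ⁿ⁺¹, which enters a sweep by (1) and
-- leaves it by (6), outputs 0ⁿ⁺¹, then sweep false n, then 1 0ⁿ: every word of length
-- n + 1 exactly once. Each transition complements a single bit and every state is an
-- output state, so consecutive outputs are at Hamming distance 1 and one step apart.

open import Defs
open import Data.Bool using (Bool; true; false; not; _≟_)
open import Data.Bool.ListAction using (or)
open import Data.Bool.Properties using (¬-not; not-¬)
open import Data.Maybe using (just)
open import Data.Nat using (ℕ; zero; suc; _+_; _∸_; _≤_; z≤n; s≤s)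
open import Data.Nat.Properties
  using (+-identityʳ; +-suc; +-comm; suc-injective; m+n∸m≡n; m+n∸n≡m; ≤-reflexive)
open import Data.List using (List; []; _∷_; _++_; _∷ʳ_; map; length; drop)
open import Data.List.Properties
  using (++-assoc; length-++; map-++; map-∘; map-cong; map-id; ∷-injectiveˡ; ∷-injectiveʳ)
open import Data.Product using (Σ; _×_; _,_; proj₁; proj₂)
open import Data.Sum using (_⊎_; inj₁; inj₂; [_,_]′)
open import Data.List.Relation.Unary.All as All using (All; []; _∷_)
open import Data.List.Relation.Unary.All.Properties using (¬Any⇒All¬; ++⁺; map⁺; ∷ʳ⁺)
open import Data.List.Relation.Unary.AllPairs using ([]; _∷_)
open import Data.List.Relation.Unary.Any using (here; there)
open import Data.List.Relation.Unary.Linked using (Linked; [-]; _∷_)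
open import Data.List.Relation.Unary.Unique.Propositional using (Unique)
import Data.List.Relation.Unary.Unique.Propositional.Properties as Unique
open import Data.List.Relation.Binary.Disjoint.Propositional using (Disjoint)
open import Data.List.Membership.Propositional using (_∈_; _∉_)
open import Data.List.Membership.Propositional.Properties using (∈-++⁺ˡ; ∈-++⁺ʳ; ∈-map⁺; map∷⁻)
open import Relation.Binary.Construct.Closure.ReflexiveTransitive using (Star; ε; _◅_; _◅◅_)
open import Relation.Nullary using (Dec; yes; no)
open import Relation.Binary.PropositionalEquality

zeros-length : ∀ n → length (zeros n) ≡ n
zeros-length zero    = refl
zeros-length (suc n) = cong suc (zeros-length n)

or-zeros : ∀ n → or (zeros n) ≡ false
or-zeros zero    = refl
or-zeros (suc n) = or-zeros n

or≡false⇒zeros : ∀ t → or t ≡ false → t ≡ zeros (length t)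
or≡false⇒zeros []          _  = refl
or≡false⇒zeros (false ∷ t) eq = cong (false ∷_) (or≡false⇒zeros t eq)

ham-self : ∀ w → ham w w ≡ 0
ham-self []          = refl
ham-self (true ∷ w)  = ham-self w
ham-self (false ∷ w) = ham-self w

ham-setR-not : ∀ w i {b} → cellR w i ≡ bit b → ham w (setR w i (not b)) ≡ 1
ham-setR-not (true ∷ w)  zero    refl = cong suc (ham-self w)
ham-setR-not (false ∷ w) zero    refl = cong suc (ham-self w)
ham-setR-not (true ∷ w)  (suc i) e    = ham-setR-not w i e
ham-setR-not (false ∷ w) (suc i) e    = ham-setR-not w i e

ham-set-not : ∀ w i {b} → cell w i ≡ bit b → ham w (set w i (not b)) ≡ 1
ham-set-not w (suc i) = ham-setR-not w i

cm1≡bit⇒cell : ∀ w h {x} → cm1 w h ≡ bit x → cell w (h ∸ 1) ≡ bit x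
cm1≡bit⇒cell w (suc h) e = e

cm2≡bit⇒cell : ∀ w h {x} → cm2 w h ≡ bit x → cell w (h ∸ 2) ≡ bit x
cm2≡bit⇒cell w (suc (suc h)) e = e

_⇝_ : Config → Config → Set
c ⇝ c′ = step c ≡ just c′ × ham (word c) (word c′) ≡ 1

transition₁ : ∀ w h → cm1 w h ≡ ▷ → c0 w h ≡ bit false → cp1 w h ≡ bit false →
              ⟨ qi , w , h ⟩ ⇝ ⟨ down , set w (suc h) true , suc h ⟩
transition₁ w h e₁ e₂ e₃ rewrite e₁ | e₂ | e₃ = refl , ham-set-not w (suc h) e₃

transition₂ : ∀ w h {x} → leftOK (cm2 w h) ≡ true → cm1 w h ≡ bit x →
              c0 w h ≡ bit true → cp1 w h ≡ bit false →
              ⟨ down , w , h ⟩ ⇝ ⟨ down , set w (suc h) true , suc h ⟩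
transition₂ w h e₁ e₂ e₃ e₄ rewrite e₁ | e₂ | e₃ | e₄ = refl , ham-set-not w (suc h) e₄

transition₃ : ∀ w h {x} → leftOK (cm2 w h) ≡ true → cm1 w h ≡ bit x →
              c0 w h ≡ bit true → cp1 w h ≡ ◁ →
              ⟨ down , w , h ⟩ ⇝ ⟨ up , set w (h ∸ 1) (not x) , h ⟩
transition₃ w h e₁ e₂ e₃ e₄ rewrite e₁ | e₂ | e₃ | e₄ =
  refl , ham-set-not w (h ∸ 1) (cm1≡bit⇒cell w h e₂)

transition₄ : ∀ w h {x} → cm2 w h ≡ bit x → cm1 w h ≡ bit false →
              c0 w h ≡ bit true → rightOK (cp1 w h) ≡ true →
              ⟨ up , w , h ⟩ ⇝ ⟨ down , set w (h ∸ 2) (not x) , h ⟩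
transition₄ w h e₁ e₂ e₃ e₄ rewrite e₁ | e₂ | e₃ | e₄ =
  refl , ham-set-not w (h ∸ 2) (cm2≡bit⇒cell w h e₁)

transition₅ : ∀ w h {x} → cm2 w h ≡ bit x → cm1 w h ≡ bit true →
              c0 w h ≡ bit true → rightOK (cp1 w h) ≡ true →
              ⟨ up , w , h ⟩ ⇝ ⟨ up , set w h false , h ∸ 1 ⟩
transition₅ w h e₁ e₂ e₃ e₄ rewrite e₁ | e₂ | e₃ | e₄ = refl , ham-set-not w h e₃

transition₆ : ∀ w h → cm2 w h ≡ ▷ → cm1 w h ≡ bit true →
              c0 w h ≡ bit true → cp1 w h ≡ bit false →
              ⟨ up , w , h ⟩ ⇝ ⟨ qh , set w h false , h ∸ 1 ⟩
transition₆ w h e₁ e₂ e₃ e₄ rewrite e₁ | e₂ | e₃ | e₄ = refl , ham-set-not w h e₃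

-- The offset is written i + length p so that the instances i = 0, 1, 2, 3 are
-- definitionally the cells around a head placed just after p.
cellR-++ : ∀ p r i → cellR (p ++ r) (i + length p) ≡ cellR r i
cellR-++ []      r i rewrite +-identityʳ i       = refl
cellR-++ (_ ∷ p) r i rewrite +-suc i (length p) = cellR-++ p r i

setR-++ : ∀ p r i b → setR (p ++ r) (i + length p) b ≡ p ++ setR r i b
setR-++ []      r i b rewrite +-identityʳ i       = refl
setR-++ (a ∷ p) r i b rewrite +-suc i (length p) = cong (a ∷_) (setR-++ p r i b)

setR-++-config : ∀ s p r i b h →
                 ⟨ s , setR (p ++ r) (i + length p) b , h ⟩ ≡ ⟨ s , p ++ setR r i b , h ⟩
setR-++-config s p r i b h = cong (λ w → ⟨ s , w , h ⟩) (setR-++ p r i b)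

leftOK-before : ∀ p r → leftOK (cell (p ++ r) (length p)) ≡ true
leftOK-before []          r = refl
leftOK-before (_ ∷ [])    r = refl
leftOK-before (_ ∷ b ∷ p) r = leftOK-before (b ∷ p) r

rightOK-zeros : ∀ n → rightOK (cellR (zeros n) 0) ≡ true
rightOK-zeros zero    = refl
rightOK-zeros (suc n) = refl

pivot : ℕ → List Bool
pivot n = true ∷ zeros n

at : State → List Bool → Bool → ℕ → Config
at s p x k = ⟨ s , p ++ x ∷ pivot k , suc (suc (length p)) ⟩

at-∷ʳ : ∀ s p x y k →
        at s (p ∷ʳ x) y k ≡ ⟨ s , p ++ x ∷ y ∷ pivot k , suc (suc (suc (length p))) ⟩
at-∷ʳ s p x y k
  rewrite ++-assoc p (x ∷ []) (y ∷ pivot k) | length-++ p {x ∷ []} | +-comm (length p) 1 = refl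

turn : ∀ p x → at down p x 0 ⇝ at up p (not x) 0
turn p x = subst (at down p x 0 ⇝_) (setR-++-config up p r 0 (not x) _)
  (transition₃ (p ++ r) _ (leftOK-before p r) (cellR-++ p r 0) (cellR-++ p r 1) (cellR-++ p r 2))
  where r = x ∷ true ∷ []

descend : ∀ p x k → at down p x (suc k) ⇝ at down (p ∷ʳ x) true k
descend p x k =
  subst (at down p x (suc k) ⇝_)
        (trans (setR-++-config down p r 2 true _) (sym (at-∷ʳ down p x true k)))
        (transition₂ (p ++ r) _ (leftOK-before p r) (cellR-++ p r 0) (cellR-++ p r 1) (cellR-++ p r 2))
  where r = x ∷ true ∷ false ∷ zeros k

flip : ∀ p x k → at up (p ∷ʳ x) false k ⇝ at down (p ∷ʳ not x) false k
flip p x k =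
  subst₂ _⇝_ (sym (at-∷ʳ up p x false k))
         (trans (setR-++-config down p r 0 (not x) _) (sym (at-∷ʳ down p (not x) false k)))
         (transition₄ (p ++ r) _ (cellR-++ p r 0) (cellR-++ p r 1) (cellR-++ p r 2)
                      (trans (cong rightOK (cellR-++ p r 3)) (rightOK-zeros k)))
  where r = x ∷ false ∷ true ∷ zeros k

ascend : ∀ p y k → at up (p ∷ʳ y) true k ⇝ at up p y (suc k)
ascend p y k =
  subst₂ _⇝_ (sym (at-∷ʳ up p y true k)) (setR-++-config up p r 2 false _)
         (transition₅ (p ++ r) _ (cellR-++ p r 0) (cellR-++ p r 1) (cellR-++ p r 2)
                      (trans (cong rightOK (cellR-++ p r 3)) (rightOK-zeros k)))
  where r = y ∷ true ∷ true ∷ zeros k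

visited : ∀ {c c′} → Star _⇝_ c c′ → List (List Bool)
visited         ε       = []
visited {c = c} (_ ◅ r) = word c ∷ visited r

visited-◅◅ : ∀ {c c′ c″} (r : Star _⇝_ c c′) (r′ : Star _⇝_ c′ c″) →
             visited (r ◅◅ r′) ≡ visited r ++ visited r′
visited-◅◅ ε       r′ = refl
visited-◅◅ (_ ◅ r) r′ = cong (_ ∷_) (visited-◅◅ r r′)

run-iter : ∀ {c c′} (r : Star _⇝_ c c′) → iter (length (visited r)) c ≡ just c′
run-iter ε             = refl
run-iter ((e , _) ◅ r) rewrite e = run-iter r

run-outputs : ∀ {c c′} (r : Star _⇝_ c c′) t →
              map proj₂ (outs (trace t (length (visited r)) c)) ≡ visited r ∷ʳ word c′
run-outputs ε             t = refl
run-outputs ((e , _) ◅ r) t rewrite e = cong (_ ∷_) (run-outputs r (suc t))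

run-gray : ∀ {c c′} (r : Star _⇝_ c c′) → Linked (λ u v → ham u v ≡ 1) (visited r ∷ʳ word c′)
run-gray ε                     = [-]
run-gray ((_ , d) ◅ ε)         = d ∷ [-]
run-gray ((_ , d) ◅ r@(_ ◅ _)) = d ∷ run-gray r

run-delay : ∀ {c c′} (r : Star _⇝_ c c′) {s} t → t ∸ s ≤ 1 →
            Linked (λ u v → v ∸ u ≤ 1)
                   (s ∷ map proj₁ (outs (trace t (length (visited r)) c)) ++ (t + length (visited r)) ∷ [])
run-delay ε             t gap = gap ∷ subst (_≤ 1) (sym (m+n∸m≡n t 0)) z≤n ∷ [-]
run-delay ((e , _) ◅ r) t gap rewrite e | +-suc t (length (visited r)) =
  gap ∷ run-delay r (suc t) (≤-reflexive (m+n∸n≡m 1 t))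

sweep : Bool → ℕ → List (List Bool)
sweep x zero    = []
sweep x (suc n) = map (x ∷_) (pivot n ∷ sweep true n) ++ map (not x ∷_) (sweep false n ∷ʳ pivot n)

map-++-∷ : ∀ p x (L : List (List Bool)) → map (p ++_) (map (x ∷_) L) ≡ map ((p ∷ʳ x) ++_) L
map-++-∷ p x L = trans (sym (map-∘ L)) (map-cong (λ s → sym (++-assoc p (x ∷ []) s)) L)

map-++-sweep : ∀ p x n → map (p ++_) (sweep x (suc n)) ≡
  (p ++ x ∷ pivot n) ∷ map ((p ∷ʳ x) ++_) (sweep true n)
    ++ map ((p ∷ʳ not x) ++_) (sweep false n) ∷ʳ (p ++ not x ∷ pivot n)
map-++-sweep p x n = begin
  map (p ++_) (map (x ∷_) (pivot n ∷ A) ++ map (not x ∷_) (B ∷ʳ pivot n))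
    ≡⟨ map-++ (p ++_) (map (x ∷_) (pivot n ∷ A)) _ ⟩
  w ∷ map (p ++_) (map (x ∷_) A) ++ map (p ++_) (map (not x ∷_) (B ∷ʳ pivot n))
    ≡⟨ cong₂ (λ u v → w ∷ u ++ v) (map-++-∷ p x A) (map-++-∷ p (not x) (B ∷ʳ pivot n)) ⟩
  w ∷ map ((p ∷ʳ x) ++_) A ++ map ((p ∷ʳ not x) ++_) (B ∷ʳ pivot n)
    ≡⟨ cong (λ v → w ∷ map ((p ∷ʳ x) ++_) A ++ v)
            (trans (map-++ _ B _) (cong (map _ B ∷ʳ_) (++-assoc p _ _))) ⟩
  w ∷ map ((p ∷ʳ x) ++_) A ++ map ((p ∷ʳ not x) ++_) B ∷ʳ (p ++ not x ∷ pivot n) ∎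
  where
  open ≡-Reasoning
  A = sweep true n
  B = sweep false n
  w = p ++ x ∷ pivot n

sweep-run : ∀ k p x → Σ (Star _⇝_ (at down p x k) (at up p (not x) k)) λ r →
            visited r ∷ʳ word (at up p (not x) k) ≡ map (p ++_) (sweep x (suc k))
sweep-run zero    p x = turn p x ◅ ε , refl
sweep-run (suc k) p x with sweep-run k (p ∷ʳ x) true | sweep-run k (p ∷ʳ not x) false
... | r₁ , e₁ | r₂ , e₂ = descend p x k ◅ r₁ ◅◅ flip p x k ◅ r₂ ◅◅ ascend p (not x) k ◅ ε , words
  where
  open ≡-Reasoning
  w₀ = p ++ x ∷ pivot (suc k)
  w₁ = word (at up (p ∷ʳ x) false k)
  w₂ = word (at up (p ∷ʳ not x) true k)
  w₃ = p ++ not x ∷ pivot (suc k)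
  words : w₀ ∷ visited (r₁ ◅◅ flip p x k ◅ r₂ ◅◅ ascend p (not x) k ◅ ε) ∷ʳ w₃
          ≡ map (p ++_) (sweep x (suc (suc k)))
  words = begin
    w₀ ∷ visited (r₁ ◅◅ flip p x k ◅ r₂ ◅◅ ascend p (not x) k ◅ ε) ∷ʳ w₃
      ≡⟨ cong (λ ws → w₀ ∷ ws ∷ʳ w₃)
              (trans (visited-◅◅ r₁ _) (cong (λ ws → visited r₁ ++ w₁ ∷ ws) (visited-◅◅ r₂ _))) ⟩
    w₀ ∷ (visited r₁ ++ w₁ ∷ visited r₂ ++ w₂ ∷ []) ∷ʳ w₃
      ≡⟨ cong (w₀ ∷_) (trans (++-assoc (visited r₁) _ _) (sym (++-assoc (visited r₁) (w₁ ∷ []) _))) ⟩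
    w₀ ∷ (visited r₁ ∷ʳ w₁) ++ (visited r₂ ∷ʳ w₂) ∷ʳ w₃
      ≡⟨ cong₂ (λ u v → w₀ ∷ u ++ v ∷ʳ w₃) e₁ e₂ ⟩
    w₀ ∷ map ((p ∷ʳ x) ++_) (sweep true (suc k)) ++ map ((p ∷ʳ not x) ++_) (sweep false (suc k)) ∷ʳ w₃
      ≡⟨ map-++-sweep p x (suc k) ⟨
    map (p ++_) (sweep x (suc (suc k))) ∎

pivot-length : ∀ n → length (pivot n) ≡ suc n
pivot-length n = cong suc (zeros-length n)

sweep-length : ∀ x n → All (λ s → length s ≡ suc n) (sweep x n)
sweep-length x zero    = []
sweep-length x (suc n) =
  ++⁺ (map⁺ (All.map (cong suc) (pivot-length n ∷ sweep-length true n)))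
      (map⁺ (All.map (cong suc) (∷ʳ⁺ (sweep-length false n) (pivot-length n))))

or-drop : ∀ s → or (drop 1 s) ≡ true → or s ≡ true
or-drop (false ∷ s) e = e
or-drop (true  ∷ s) e = refl

sweep-tail : ∀ x n → All (λ s → or (drop 1 s) ≡ true) (sweep x n)
sweep-tail x zero    = []
sweep-tail x (suc n) =
  ++⁺ (map⁺ (refl ∷ All.map (λ {s} → or-drop s) (sweep-tail true n)))
      (map⁺ (∷ʳ⁺ (All.map (λ {s} → or-drop s) (sweep-tail false n)) refl))

zero-tail∉sweep : ∀ x n b → b ∷ zeros n ∉ sweep x n
zero-tail∉sweep x n b m with () ← trans (sym (or-zeros n)) (All.lookup (sweep-tail x n) m)

map-∷-disjoint : ∀ {x y} {xs ys : List (List Bool)} → x ≢ y → Disjoint (map (x ∷_) xs) (map (y ∷_) ys)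
map-∷-disjoint x≢y (m₁ , m₂) with _ , _ , refl ← map∷⁻ m₁ | _ , _ , e ← map∷⁻ m₂ =
  x≢y (∷-injectiveˡ e)

sweep-unique : ∀ x n → Unique (sweep x n)
sweep-unique x zero    = []
sweep-unique x (suc n) = Unique.++⁺
  (Unique.map⁺ ∷-injectiveʳ (¬Any⇒All¬ _ (zero-tail∉sweep true n true) ∷ sweep-unique true n))
  (Unique.map⁺ ∷-injectiveʳ (Unique.++⁺ (sweep-unique false n) ([] ∷ [])
                                        λ where (m , here refl) → zero-tail∉sweep false n true m))
  (map-∷-disjoint (not-¬ refl))

nonzero-split : ∀ b t → or (b ∷ t) ≡ true → b ∷ t ≡ pivot (length t) ⊎ or t ≡ true
nonzero-split false t nz = inj₂ nz
nonzero-split true  t _  with or t in eq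
... | true  = inj₂ refl
... | false = inj₁ (cong (true ∷_) (or≡false⇒zeros t eq))

sweep-complete : ∀ x n a t → length t ≡ n → or t ≡ true → a ∷ t ∈ sweep x n
sweep-complete _ zero    _ []      _   ()
sweep-complete _ (suc n) _ []      ()  _
sweep-complete x (suc n) a (b ∷ t) len nz = place (a ≟ x)
  where
  pivot-or-sweep : ∀ y → b ∷ t ≡ pivot n ⊎ b ∷ t ∈ sweep y n
  pivot-or-sweep y with nonzero-split b t nz
  ... | inj₁ e   = inj₁ (trans e (cong pivot (suc-injective len)))
  ... | inj₂ nz′ = inj₂ (sweep-complete y n b t (suc-injective len) nz′)

  place : Dec (a ≡ x) → a ∷ b ∷ t ∈ sweep x (suc n)
  place (yes refl) = ∈-++⁺ˡ (∈-map⁺ (a ∷_) ([ here , there ]′ (pivot-or-sweep true)))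
  place (no a≢x) rewrite ¬-not a≢x =
    ∈-++⁺ʳ _ (∈-map⁺ (not x ∷_) ([ (λ e → ∈-++⁺ʳ _ (here e)) , ∈-++⁺ˡ ]′ (pivot-or-sweep false)))

enumeration : ℕ → List (List Bool)
enumeration n = zeros (suc n) ∷ (sweep false n ∷ʳ pivot n)

enumeration-length : ∀ n → All (λ w → length w ≡ suc n) (enumeration n)
enumeration-length n = zeros-length (suc n) ∷ ∷ʳ⁺ (sweep-length false n) (pivot-length n)

enumeration-unique : ∀ n → Unique (enumeration n)
enumeration-unique n =
  ∷ʳ⁺ (¬Any⇒All¬ _ (zero-tail∉sweep false n false)) (λ ()) ∷
  Unique.++⁺ (sweep-unique false n) ([] ∷ []) λ where (m , here refl) → zero-tail∉sweep false n true m

enumeration-complete : ∀ n w → length w ≡ suc n → w ∈ enumeration n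
enumeration-complete n (a ∷ t) len with or t in eq
... | true  = there (∈-++⁺ˡ (sweep-complete false n a t (suc-injective len) eq))
... | false with trans (or≡false⇒zeros t eq) (cong zeros (suc-injective len))
...   | refl with a
...     | false = here refl
...     | true  = there (∈-++⁺ʳ _ (here refl))

T₁-run : ∀ k → Σ (Star _⇝_ (init (3 + k)) ⟨ qh , pivot (2 + k) , 1 ⟩) λ r →
         visited r ∷ʳ pivot (2 + k) ≡ enumeration (2 + k)
T₁-run k with sweep-run (suc k) [] false
... | r , e = start ◅ r ◅◅ halt ◅ ε , cong (zeros (3 + k) ∷_) (begin
    visited (r ◅◅ halt ◅ ε) ∷ʳ pivot (2 + k)
      ≡⟨ cong (_∷ʳ pivot (2 + k)) (visited-◅◅ r (halt ◅ ε)) ⟩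
    (visited r ∷ʳ word (at up [] true (suc k))) ∷ʳ pivot (2 + k)
      ≡⟨ cong (_∷ʳ pivot (2 + k)) (trans e (map-id _)) ⟩
    sweep false (2 + k) ∷ʳ pivot (2 + k) ∎)
  where
  open ≡-Reasoning
  start : init (3 + k) ⇝ at down [] false (suc k)
  start = transition₁ (zeros (3 + k)) 1 refl refl refl
  halt : at up [] true (suc k) ⇝ ⟨ qh , pivot (2 + k) , 1 ⟩
  halt = transition₆ (true ∷ pivot (suc k)) 2 refl refl refl refl

proposition5 : Σ ℕ λ B → (ℓ : ℕ) → 3 ≤ ℓ →
    Σ ℕ λ N → HaltsAt (init ℓ) N
      × All (λ w → length w ≡ ℓ) (map proj₂ (outputs ℓ N))
      × Unique (map proj₂ (outputs ℓ N))
      × ((w : List Bool) → length w ≡ ℓ → w ∈ map proj₂ (outputs ℓ N))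
      × Linked (λ u v → ham u v ≡ 1) (map proj₂ (outputs ℓ N))
      × DelayBounded B N (map proj₁ (outputs ℓ N))
proposition5 = 1 , λ where
  (suc (suc (suc k))) (s≤s (s≤s (s≤s z≤n))) →
    let r , words = T₁-run k
        outputs≡enumeration = trans (run-outputs r 0) words
    in length (visited r) , (_ , run-iter r , refl)
       , subst (All _) (sym outputs≡enumeration) (enumeration-length (2 + k))
       , subst Unique (sym outputs≡enumeration) (enumeration-unique (2 + k))
       , (λ w len → subst (w ∈_) (sym outputs≡enumeration) (enumeration-complete (2 + k) w len))
       , subst (Linked _) (sym (run-outputs r 0)) (run-gray r)
       , run-delay r 0 z≤n
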